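{- Let $S$ and $T$ be association schemes on finite sets $X$ and $Y$, with $T$ thin. Then every morphism $\phi$ from $S$ to $T$ is admissible, and $\ker\phi$ contains the thin residue $O^\vartheta(S)$.
   Context: An association scheme on a finite set $X$ is a partition $S$ of $X\times X$ into nonempty subsets such that $1_X=\{(x,x)\}\in S$; $s^*=\{(x,y):(y,x)\in s\}\in S$; and for $p,q,r\in S$ there is $a_{pq}^r\ge0$ with $|\{y:(x,y)\in p,(y,z)\in q\}|=a_{pq}^r$ whenever $(x,z)\in r$. A scheme is thin if $|\{y:(x,y)\in t\}|=1$ for all $x$ and all its elements $t$. Complex product: $PQ=\{r:a_{pq}^r>0\text{ for some }p\in P,q\in Q\}$. A nonempty $U\subseteq S$ is closed if $UU=U$ and strongly normal if $p^*Up=U$ for all $p\in S$ (with $p^*Up=\{p^*\}U\{p\}$). The thin residue $O^\vartheta(S)$ is the intersection of all strongly normal closed subsets of $S$. A morphism from $S$ on $X$ to $T$ on $Y$ is a function $\phi:X\cup S\to Y\cup T$ with $\phi(X)\subseteq Y$, $\phi(S)\subseteq T$, $(\phi(x_1),\phi(x_2))\in\phi(s)$ whenever $(x_1,x_2)\in s$; it is admissible if whenever $(\phi(x),y)\in\phi(s)$ there is $x'\in X$ with $\phi(x')=y$ and $(x,x')\in s$. $\ker\phi=\{s\in S:\phi(s)=1_Y\}$. -}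

module Defs where

open import Data.Nat using (ℕ; _<_)
open import Data.Fin using (Fin)
open import Data.Fin.Properties using (_≟_)
open import Data.Fin.Subset using (Subset; _∈_)
open import Data.List using (length; filter; allFin)
open import Data.Product using (Σ; ∃; ∃-syntax; _×_; _,_)
open import Relation.Nullary.Decidable using (_×-dec_)
open import Relation.Binary.PropositionalEquality using (_≡_)
open import Function.Bundles using (_⇔_)

-- number of y ∈ X with (x,y) ∈ p and (y,z) ∈ q, where a scheme is given by
-- a labelling  rel : X × X → S  of pairs by the (indices of the) classes of the partition
pathCount : ∀ {n m} → (Fin n → Fin n → Fin m) → Fin n → Fin n → Fin m → Fin m → ℕ
pathCount {n} rel x z p q =
  length (filter (λ y → (rel x y ≟ p) ×-dec (rel y z ≟ q)) (allFin n))

outCount : ∀ {n m} → (Fin n → Fin n → Fin m) → Fin n → Fin m → ℕ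
outCount {n} rel x t = length (filter (λ y → rel x y ≟ t) (allFin n))

-- An association scheme on the finite set X = Fin n.
-- The partition S of X × X is given by m nonempty classes, indexed by Fin m;
-- rel x y is the class containing (x , y).
record AssocScheme (n : ℕ) : Set where
  field
    m        : ℕ
    rel      : Fin n → Fin n → Fin m
    nonempty : ∀ (s : Fin m) → ∃[ x ] ∃[ y ] rel x y ≡ s
    one      : Fin m
    one-spec : ∀ x y → (rel x y ≡ one) ⇔ (x ≡ y)
    inv      : Fin m → Fin m
    inv-spec : ∀ s x y → (rel x y ≡ inv s) ⇔ (rel y x ≡ s)
    a        : Fin m → Fin m → Fin m → ℕ
    a-spec   : ∀ p q r x z → rel x z ≡ r → pathCount rel x z p q ≡ a p q r

open AssocScheme public

module _ {n : ℕ} (S : AssocScheme n) where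

  Thin : Set
  Thin = ∀ (x : Fin n) (t : Fin (m S)) → outCount (rel S) x t ≡ 1

  Prod : (Fin (m S) → Set) → (Fin (m S) → Set) → Fin (m S) → Set
  Prod P Q r = ∃[ p ] ∃[ q ] (P p × Q q × 0 < a S p q r)

  Closed : Subset (m S) → Set
  Closed U = (∃[ s ] s ∈ U) × (∀ r → Prod (_∈ U) (_∈ U) r ⇔ r ∈ U)

  StronglyNormal : Subset (m S) → Set
  StronglyNormal U =
    ∀ p r → Prod (Prod (_≡ inv S p) (_∈ U)) (_≡ p) r ⇔ r ∈ U

  InThinResidue : Fin (m S) → Set
  InThinResidue s = ∀ (U : Subset (m S)) → Closed U → StronglyNormal U → s ∈ U

record Morphism {n n' : ℕ} (S : AssocScheme n) (T : AssocScheme n') : Set where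
  field
    onX  : Fin n → Fin n'
    onS  : Fin (m S) → Fin (m T)
    resp : ∀ x₁ x₂ → rel T (onX x₁) (onX x₂) ≡ onS (rel S x₁ x₂)

open Morphism public

module _ {n n' : ℕ} {S : AssocScheme n} {T : AssocScheme n'} where

  Admissible : Morphism S T → Set
  Admissible φ = ∀ (x : Fin n) (s : Fin (m S)) (y : Fin n') →
    rel T (onX φ x) y ≡ onS φ s → ∃[ x' ] (onX φ x' ≡ y × rel S x x' ≡ s)

  InKer : Morphism S T → Fin (m S) → Set
  InKer φ s = onS φ s ≡ one T

module Submission where

-- Structure constants are counts of paths, so a_pq^r > 0 holds exactly
-- when some (equivalently every) pair (x,z) ∈ r is joined by a path
-- x -p-> y -q-> z; in particular every point has an s-successor for each
-- relation s (take r = 1 and q = s*).  In a thin scheme successors are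
-- unique.  For a morphism φ : S → T with T thin, admissibility follows:
-- choose an s-successor x' of x; then φ(x') and y are both φ(s)-successors
-- of φ(x), hence equal.  The kernel of φ consists of the relations whose
-- pairs have equal images under φ; it is closed for every morphism, and
-- strongly normal when T is thin (using admissibility and uniqueness of
-- successors in T).  As the thin residue is the intersection of all
-- strongly normal closed subsets, it lies in the kernel.

open import Defs
open import Data.Nat using (ℕ; _<_; z≤n; s≤s)
open import Data.Fin using (Fin)
open import Data.Fin.Properties using (_≟_)
open import Data.Fin.Subset using (Subset; _∈_)
open import Data.Bool using (true)
open import Data.Product using (_×_; _,_; ∃-syntax; proj₁; proj₂)
open import Data.List using ([]; _∷_; length; filter; allFin)
open import Data.List.Relation.Unary.Any using (here)
import Data.List.Membership.Propositional as List
open import Data.List.Membership.Propositional.Properties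
  using (∈-filter⁺; ∈-filter⁻; ∈-allFin)
open import Data.Vec using (tabulate)
open import Data.Vec.Properties using (lookup⇒[]=; []=⇒lookup; lookup∘tabulate)
open import Relation.Nullary using (Dec; yes; does; _×-dec_)
open import Relation.Nullary.Decidable using (dec-true)
open import Relation.Unary using (Decidable)
open import Relation.Binary.PropositionalEquality
  using (_≡_; refl; sym; trans; cong; subst)
open import Function.Bundles using (_⇔_; mk⇔; Equivalence)
open Equivalence using (to; from)

module Counting {A : Set} {P : A → Set} (P? : Decidable P) where

  count-positive : ∀ {x xs} → x List.∈ xs → P x → 0 < length (filter P? xs)
  count-positive {xs = xs} x∈xs px with filter P? xs | ∈-filter⁺ P? x∈xs px
  ... | _ ∷ _ | _ = s≤s z≤n

  count-witness : ∀ xs → 0 < length (filter P? xs) → ∃[ x ] P x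
  count-witness xs pos with filter P? xs in eq
  ... | y ∷ _ = y , proj₂ (∈-filter⁻ P? {xs = xs} (subst (y List.∈_) (sym eq) (here refl)))

  count-one-unique : ∀ {x₁ x₂} xs → length (filter P? xs) ≡ 1 →
    x₁ List.∈ xs → x₂ List.∈ xs → P x₁ → P x₂ → x₁ ≡ x₂
  count-one-unique {x₁} {x₂} xs one x₁∈xs x₂∈xs px₁ px₂
    with filter P? xs | ∈-filter⁺ P? x₁∈xs px₁ | ∈-filter⁺ P? x₂∈xs px₂
  ... | _ ∷ [] | here refl | here refl = refl

open Counting

does-true : ∀ {A : Set} (a? : Dec A) → does a? ≡ true → A
does-true (yes a) _ = a

subsetOf : ∀ {k} {P : Fin k → Set} → Decidable P → Subset k
subsetOf P? = tabulate (λ i → does (P? i))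

∈-subsetOf : ∀ {k} {P : Fin k → Set} (P? : Decidable P) {i : Fin k} →
  i ∈ subsetOf P? ⇔ P i
∈-subsetOf P? {i} = mk⇔
  (λ i∈ → does-true (P? i) (trans (sym (lookup∘tabulate _ i)) ([]=⇒lookup i∈)))
  (λ pi → lookup⇒[]= i _ (trans (lookup∘tabulate _ i) (dec-true (P? i) pi)))

module SchemeFacts {n : ℕ} (S : AssocScheme n) where

  rel-diagonal : ∀ x → rel S x x ≡ one S
  rel-diagonal x = from (one-spec S x x) refl

  path⇒positive : ∀ {p q r x y z} → rel S x z ≡ r →
    rel S x y ≡ p → rel S y z ≡ q → 0 < a S p q r
  path⇒positive {p} {q} {r} {x} {y} {z} xz xy yz =
    subst (0 <_) (a-spec S p q r x z xz)
      (count-positive (λ w → (rel S x w ≟ p) ×-dec (rel S w z ≟ q)) (∈-allFin y) (xy , yz))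

  positive⇒path : ∀ {p q r x z} → rel S x z ≡ r → 0 < a S p q r →
    ∃[ y ] (rel S x y ≡ p × rel S y z ≡ q)
  positive⇒path {p} {q} {r} {x} {z} xz pos =
    count-witness (λ w → (rel S x w ≟ p) ×-dec (rel S w z ≟ q)) (allFin n)
      (subst (0 <_) (sym (a-spec S p q r x z xz)) pos)

  -- Every point has an s-successor: a_{s s*}^1 > 0 is witnessed at any
  -- pair in s, and then realised at (x,x).
  successor : ∀ x s → ∃[ y ] rel S x y ≡ s
  successor x s =
    let (x₀ , y₀ , x₀y₀) = nonempty S s
        pos = path⇒positive (rel-diagonal x₀) x₀y₀ (from (inv-spec S s y₀ x₀) x₀y₀)
        (y , xy , _) = positive⇒path (rel-diagonal x) pos
    in y , xy

  thin-successor-unique : Thin S → ∀ {u t y₁ y₂} →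
    rel S u y₁ ≡ t → rel S u y₂ ≡ t → y₁ ≡ y₂
  thin-successor-unique thin {u} {t} =
    count-one-unique (λ y → rel S u y ≟ t) (allFin n) (thin u t) (∈-allFin _) (∈-allFin _)

open SchemeFacts

module MorphismFacts {n n' : ℕ} {S : AssocScheme n} {T : AssocScheme n'}
                     (φ : Morphism S T) where

  admissible : Thin T → Admissible φ
  admissible thin x s y φxy =
    let (x' , xx') = successor S x s
        φxx' = trans (resp φ x x') (cong (onS φ) xx')
    in x' , thin-successor-unique T thin φxx' φxy , xx'

  kernel : Subset (m S)
  kernel = subsetOf (λ s → onS φ s ≟ one T)

  ∈-kernel : ∀ {s} → s ∈ kernel ⇔ InKer φ s
  ∈-kernel = ∈-subsetOf (λ s → onS φ s ≟ one T)

  ∈-kernel-at : ∀ {x y s} → rel S x y ≡ s → s ∈ kernel ⇔ onX φ x ≡ onX φ y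
  ∈-kernel-at {x} {y} refl = mk⇔
    (λ s∈ → to (one-spec T _ _) (trans (resp φ x y) (to ∈-kernel s∈)))
    (λ same → from ∈-kernel (trans (sym (resp φ x y)) (from (one-spec T _ _) same)))

  ker⇒same-image : ∀ {x y s} → rel S x y ≡ s → s ∈ kernel → onX φ x ≡ onX φ y
  ker⇒same-image xy = to (∈-kernel-at xy)

  same-image⇒ker : ∀ {x y s} → rel S x y ≡ s → onX φ x ≡ onX φ y → s ∈ kernel
  same-image⇒ker xy = from (∈-kernel-at xy)

  one∈kernel : one S ∈ kernel
  one∈kernel = same-image⇒ker (rel-diagonal S (proj₁ (nonempty S (one S)))) refl

  -- The kernel of any morphism is closed: paths of kernel relations do not
  -- move the image, and r = r·1 for r in the kernel.
  kernel-closed : Closed S kernel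
  kernel-closed = (one S , one∈kernel) , λ r → mk⇔ (product⊆ r) (⊆product r)
    where
    product⊆ : ∀ r → Prod S (_∈ kernel) (_∈ kernel) r → r ∈ kernel
    product⊆ r (p , q , p∈ , q∈ , pos) =
      let (x , z , xz) = nonempty S r
          (y , xy , yz) = positive⇒path S xz pos
      in same-image⇒ker xz (trans (ker⇒same-image xy p∈) (ker⇒same-image yz q∈))

    ⊆product : ∀ r → r ∈ kernel → Prod S (_∈ kernel) (_∈ kernel) r
    ⊆product r r∈ =
      let (x , z , xz) = nonempty S r
      in r , one S , r∈ , one∈kernel , path⇒positive S xz xz (rel-diagonal S z)

  kernel-normal : Thin T → StronglyNormal S kernel
  kernel-normal thin p r = mk⇔ conjugate⊆ ⊆conjugate
    where
    -- r ∈ p* U p: over (x,z) ∈ r there are x -p*-> w -u-> y -p-> z with u in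
    -- the kernel; φ(x) and φ(z) are both φ(p)-successors of φ(w) = φ(y).
    conjugate⊆ : Prod S (Prod S (_≡ inv S p) (_∈ kernel)) (_≡ p) r → r ∈ kernel
    conjugate⊆ (p' , _ , (_ , u , refl , u∈ , pos') , refl , pos) =
      let (x , z , xz) = nonempty S r
          (y , xy , yz) = positive⇒path S xz pos
          (w , xw , wy) = positive⇒path S xy pos'
          wx = to (inv-spec S p x w) xw
          φwx = trans (resp φ w x) (cong (onS φ) wx)
          φwz = trans (cong (λ v → rel T v (onX φ z)) (ker⇒same-image wy u∈))
                      (trans (resp φ y z) (cong (onS φ) yz))
      in same-image⇒ker xz (thin-successor-unique T thin φwx φwz)

    -- r in the kernel, (x,z) ∈ r: take a p*-successor w of x and lift the
    -- edge φ(z) -φ(p*)-> φ(w) by admissibility to z -p*-> y; then the path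
    -- x -p*-> w -(rel w y)-> y -p-> z places r in p* U p.
    ⊆conjugate : r ∈ kernel → Prod S (Prod S (_≡ inv S p) (_∈ kernel)) (_≡ p) r
    ⊆conjugate r∈ =
      let (x , z , xz) = nonempty S r
          (w , xw) = successor S x (inv S p)
          φzw = trans (cong (λ v → rel T v (onX φ w)) (sym (ker⇒same-image xz r∈)))
                      (trans (resp φ x w) (cong (onS φ) xw))
          (y , φy≡φw , zy) = admissible thin z (inv S p) (onX φ w) φzw
          yz = to (inv-spec S p z y) zy
      in rel S x y , p
           , (inv S p , rel S w y , refl , same-image⇒ker refl (sym φy≡φw)
              , path⇒positive S refl xw refl)
           , refl , path⇒positive S xz refl yz

open MorphismFacts

lemma3p14 : ∀ {n n' : ℕ} (S : AssocScheme n) (T : AssocScheme n') → Thin T →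
    (φ : Morphism S T) →
    Admissible φ × (∀ (s : Fin (m S)) → InThinResidue S s → InKer φ s)
lemma3p14 S T thin φ =
  admissible φ thin ,
  λ s s∈residue → to (∈-kernel φ) (s∈residue (kernel φ) (kernel-closed φ) (kernel-normal φ thin))
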